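{- Let $b\ge2$ be an integer and let $q(n)=\frac{b^{n+1}-b}{b-1}$ and $r(n)=\frac{b^n-1}{b-1}$. Then for each $n\ge0$, the number of $b$-restricted $b$-ary overpartitions of $q(n)$ is $\tfrac12(3^{n+1}-1)$, and the number of $b$-restricted $b$-ary overpartitions of $r(n)$ is $\tfrac12(3^n+1)$.
   Context: For an integer base $b\ge2$, a $b$-ary overpartition of a nonnegative integer $m$ is a non-increasing sequence of nonnegative integer powers of $b$ with sum $m$, in which the first occurrence of each power of $b$ may be overlined (the empty sequence is the unique overpartition of $0$). It is $b$-restricted if each power of $b$ occurs at most $b$ times as a non-overlined part. -}

module Defs where

open import Data.Nat using (ℕ; zero; suc; _+_; _*_; _∸_; _^_; _≤_; _≡ᵇ_; NonZero; _/_; >-nonZero)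
open import Data.Nat.Properties using (_≟_)
open import Data.Bool using (Bool; true; false; if_then_else_)
open import Data.Product using (Σ; _×_; _,_)
open import Data.Maybe using (Maybe; just; nothing)
open import Data.Maybe.Properties using (≡-dec)
open import Data.List using (List; []; _∷_)
open import Data.List.Relation.Unary.All using (All)
open import Data.List.Relation.Unary.Linked using (Linked)
open import Data.Unit using (⊤)
open import Relation.Nullary.Decidable using (False)

-- An entry of an overpartition: the part b ^ e (stored by its exponent e)
-- together with a flag saying whether it is overlined (true = overlined).
Entry : Set
Entry = ℕ × Bool

value : ℕ → Entry → ℕ
value b (e , _) = b ^ e

partSum : ℕ → List Entry → ℕ
partSum b []      = 0
partSum b (x ∷ l) = value b x + partSum b l

NonIncreasing : ℕ → List Entry → Set
NonIncreasing b = Linked (λ x y → value b y ≤ value b x)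

-- only the first occurrence of a part may be overlined:
-- an overlined entry must not have the same part as its predecessor
-- (in a non-increasing sequence equal parts are adjacent).
-- The first argument is the part value of the predecessor, if any.
OverlineFirstFrom : ℕ → Maybe ℕ → List Entry → Set
OverlineFirstFrom b prev []                = ⊤
OverlineFirstFrom b prev ((e , false) ∷ l) = OverlineFirstFrom b (just (b ^ e)) l
OverlineFirstFrom b prev ((e , true)  ∷ l) =
  False (≡-dec _≟_ prev (just (b ^ e))) × OverlineFirstFrom b (just (b ^ e)) l

OverlineFirst : ℕ → List Entry → Set
OverlineFirst b = OverlineFirstFrom b nothing

nonOverlinedCount : ℕ → ℕ → List Entry → ℕ
nonOverlinedCount b e []                 = 0
nonOverlinedCount b e ((e' , true) ∷ l)  = nonOverlinedCount b e l
nonOverlinedCount b e ((e' , false) ∷ l) =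
  if (b ^ e) ≡ᵇ (b ^ e') then suc (nonOverlinedCount b e l) else nonOverlinedCount b e l

Restricted : ℕ → List Entry → Set
Restricted b l = All (λ x → nonOverlinedCount b (Data.Product.proj₁ x) l ≤ b) l

RestrictedOverpartition : ℕ → ℕ → Set
RestrictedOverpartition b m =
  Σ (List Entry) λ l →
    NonIncreasing b l × OverlineFirst b l × partSum b l ≡ m × Restricted b l
  where open import Relation.Binary.PropositionalEquality using (_≡_)

q : (b : ℕ) → 2 ≤ b → ℕ → ℕ
q b hb n = _/_ (b ^ suc n ∸ b) (b ∸ 1) {{>-nonZero (Data.Nat.Properties.∸-monoˡ-≤ 1 hb)}}

r : (b : ℕ) → 2 ≤ b → ℕ → ℕ
r b hb n = _/_ (b ^ n ∸ 1) (b ∸ 1) {{>-nonZero (Data.Nat.Properties.∸-monoˡ-≤ 1 hb)}}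

module Submission where

-- Group the parts of a b-restricted b-ary overpartition by size: the copies of b ^ e form a
-- digit (k , o), with k ≤ b plain copies and o ∈ {0, 1} overlined ones, of value o + k ≤ b + 1.
-- Read from the largest power down, this is a bijection between the overpartitions of m < b ^ N
-- and the strings of N digits with Σ (o + k) b ^ e = m.  A string for s + b y (s ∈ {0, 1}) ends
-- either in a digit of value s after a string for y, or in one of value s + b after a string for
-- y − 1; the values 0 and b + 1 are carried by one digit each, the values 1 … b by two.  As
-- r(n) = 1 + b + … + b ^ (n − 1), q(n) = b r(n) and r(n + 1) = 1 + b r(n), the numbers
-- countR n and countQ n of strings for r(n) and q(n) satisfy
-- countR (n + 1) = 2 countR n + countQ (n − 1) and countQ n = countR n + 2 countQ (n − 1),
-- whence 2 countR n = 3 ^ n + 1 and 2 countQ n + 1 = 3 ^ (n + 1).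

open import Defs
open import Data.Nat using (ℕ; zero; suc; _+_; _*_; _∸_; _^_; _/_; _≤_; _<_; _≡ᵇ_; z≤n; z<s;
  NonZero; >-nonZero)
open import Data.Nat.Properties
open import Data.Nat.DivMod using (m*n/n≡m)
open import Data.Nat.Tactic.RingSolver using (solve-∀)
open import Data.Bool using (Bool; true; false)
open import Data.Bool.Properties using (T-≡; T-irrelevant)
open import Data.Unit using (⊤; tt)
open import Data.Empty using (⊥)
open import Data.Maybe using (Maybe; just; nothing)
open import Data.Maybe.Properties using (just-injective)
open import Data.Product using (Σ; _×_; _,_; proj₁; proj₂)
open import Data.Sum using (_⊎_; inj₁; inj₂)
open import Data.List using (List; []; _∷_; _++_; replicate)
open import Data.List.Properties using (∷-injective)
open import Data.List.Relation.Unary.All as All using (All; []; _∷_)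
open import Data.List.Relation.Unary.All.Properties using (++⁺; replicate⁺)
open import Data.List.Relation.Unary.Linked as Linked using (Linked; []; [-]; _∷_)
open import Data.List.Relation.Unary.Linked.Properties using (Linked⇒All)
open import Data.Vec using (Vec; []; _∷_; _∷ʳ_; init; last; initLast)
open import Data.Vec.Properties using (init-∷ʳ; last-∷ʳ)
open import Data.Fin using (Fin)
open import Data.Fin.Properties using (0↔⊥; 1↔⊤; 2↔Bool; *↔×; +↔⊎)
open import Data.Product.Algebra using (Σ-assoc)
open import Data.Product.Function.NonDependent.Propositional using (_×-↔_)
open import Data.Product.Function.Dependent.Propositional using (Σ-↔; congˡ)
open import Data.Sum.Function.Propositional using (_⊎-↔_)
open import Function using (_∘_)
open import Function.Bundles using (Equivalence; _↔_; mk↔ₛ′)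
open import Function.Properties.Inverse using (↔-sym)
open import Function.Construct.Composition using (_↔-∘_)
open import Function.Related.Propositional using (K-reflexive; module EquationalReasoning)
open import Relation.Nullary using (¬_; contradiction; yes; no)
open import Relation.Nullary.Decidable using (fromWitnessFalse; toWitnessFalse)
open import Relation.Nullary.Irrelevant using (Irrelevant)
open import Relation.Binary.Definitions using (tri<; tri≈; tri>)
open import Relation.Binary.PropositionalEquality

private variable
  A B : Set
  n : ℕ

Fibre : (A → ℕ) → ℕ → Set
Fibre {A} f m = Σ A λ a → f a ≡ m

fibre-≡ : {f : A → ℕ} {m : ℕ} {x y : Fibre f m} → proj₁ x ≡ proj₁ y → x ≡ y
fibre-≡ {x = a , p} {y = .a , q} refl = cong (a ,_) (≡-irrelevant p q)

×-irrelevant : {P Q : Set} → Irrelevant P → Irrelevant Q → Irrelevant (P × Q)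
×-irrelevant irrP irrQ (p , q) (p′ , q′) = cong₂ _,_ (irrP p p′) (irrQ q q′)

⊎-irrelevant : {P Q : Set} → Irrelevant P → Irrelevant Q → (P → ¬ Q) → Irrelevant (P ⊎ Q)
⊎-irrelevant irrP irrQ disjoint (inj₁ p) (inj₁ p′) = cong inj₁ (irrP p p′)
⊎-irrelevant irrP irrQ disjoint (inj₁ p) (inj₂ q)  = contradiction q (disjoint p)
⊎-irrelevant irrP irrQ disjoint (inj₂ q) (inj₁ p)  = contradiction q (disjoint p)
⊎-irrelevant irrP irrQ disjoint (inj₂ q) (inj₂ q′) = cong inj₂ (irrQ q q′)

linked-irrelevant : {R : A → A → Set} → (∀ {x y} → Irrelevant (R x y)) → ∀ {l} → Irrelevant (Linked R l)
linked-irrelevant irrR []       []         = refl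
linked-irrelevant irrR [-]      [-]        = refl
linked-irrelevant irrR (r ∷ rs) (r′ ∷ rs′) = cong₂ _∷_ (irrR r r′) (linked-irrelevant irrR rs rs′)

irrelevant-⇔⇒↔ : {P Q : Set} → Irrelevant P → Irrelevant Q → (P → Q) → (Q → P) → P ↔ Q
irrelevant-⇔⇒↔ irrP irrQ f g = mk↔ₛ′ f g (λ _ → irrQ _ _) (λ _ → irrP _ _)

Σ²-distrib-⊎-× : {P P′ : A → Set} {Q Q′ : B → Set} →
  (Σ A λ a → Σ B λ c → (P a × Q c) ⊎ (P′ a × Q′ c)) ↔ ((Σ A P × Σ B Q) ⊎ (Σ A P′ × Σ B Q′))
Σ²-distrib-⊎-× = mk↔ₛ′
  (λ { (a , c , inj₁ (p , q)) → inj₁ ((a , p) , (c , q))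
     ; (a , c , inj₂ (p , q)) → inj₂ ((a , p) , (c , q)) })
  (λ { (inj₁ ((a , p) , (c , q))) → a , c , inj₁ (p , q)
     ; (inj₂ ((a , p) , (c , q))) → a , c , inj₂ (p , q) })
  (λ { (inj₁ _) → refl ; (inj₂ _) → refl })
  (λ { (_ , _ , inj₁ _) → refl ; (_ , _ , inj₂ _) → refl })

last-init-↔ : Vec A (suc n) ↔ (A × Vec A n)
last-init-↔ = mk↔ₛ′ (λ v → last v , init v) (λ (a , v) → v ∷ʳ a)
  (λ (a , v) → cong₂ _,_ (last-∷ʳ a v) (init-∷ʳ a v))
  (λ v → sym (proj₂ (proj₂ (initLast v))))

⊎-×-↔-Fin : ∀ {a x c y} → ((Fin a × Fin x) ⊎ (Fin c × Fin y)) ↔ Fin (a * x + c * y)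
⊎-×-↔-Fin {a} {x} {c} {y} =
  ↔-sym (+↔⊎ {a * x} {c * y}) ↔-∘ (↔-sym (*↔× {a} {x}) ⊎-↔ ↔-sym (*↔× {c} {y}))

quotient-<⇒< : ∀ {b x y t s} → t < b → x < y → t + b * x < s + b * y
quotient-<⇒< {b} {x} {y} {t} {s} t<b x<y = begin-strict
  t + b * x  <⟨ +-monoˡ-< (b * x) t<b ⟩
  b + b * x  ≡⟨ sym (*-suc b x) ⟩
  b * suc x  ≤⟨ *-monoʳ-≤ b x<y ⟩
  b * y      ≤⟨ m≤n+m (b * y) s ⟩
  s + b * y  ∎
  where open ≤-Reasoning

quotient-remainder-unique : ∀ {b x y t s} → t < b → s < b → t + b * x ≡ s + b * y → x ≡ y × t ≡ s
quotient-remainder-unique {b} {x} {y} {t} {s} t<b s<b eq with <-cmp x y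
... | tri< x<y _ _  = contradiction eq (<⇒≢ (quotient-<⇒< t<b x<y))
... | tri> _ _ y<x  = contradiction (sym eq) (<⇒≢ (quotient-<⇒< s<b y<x))
... | tri≈ _ refl _ = refl , +-cancelʳ-≡ (b * x) t s eq

carry-split : ∀ {b x y t s} → t < b + b → s < b → t + b * x ≡ s + b * y →
              (t ≡ s × x ≡ y) ⊎ (t ≡ s + b × suc x ≡ y)
carry-split {b} {x} {y} {t} {s} t<b+b s<b eq with t <? b
... | yes t<b = let x≡y , t≡s = quotient-remainder-unique t<b s<b eq in inj₁ (t≡s , x≡y)
... | no  t≮b = let 1+x≡y , t∸b≡s = quotient-remainder-unique t∸b<b s<b carried
                in inj₂ (trans (sym (m∸n+n≡m b≤t)) (cong (_+ b) t∸b≡s) , 1+x≡y)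
  where
  b≤t = ≮⇒≥ t≮b
  t∸b<b : t ∸ b < b
  t∸b<b = +-cancelˡ-< b (t ∸ b) b (subst (_< b + b) (sym (m+[n∸m]≡n b≤t)) t<b+b)
  carried : t ∸ b + b * suc x ≡ s + b * y
  carried = begin
    t ∸ b + b * suc x    ≡⟨ cong (t ∸ b +_) (*-suc b x) ⟩
    t ∸ b + (b + b * x)  ≡⟨ sym (+-assoc (t ∸ b) b (b * x)) ⟩
    t ∸ b + b + b * x    ≡⟨ cong (_+ b * x) (m∸n+n≡m b≤t) ⟩
    t + b * x            ≡⟨ eq ⟩
    s + b * y            ∎
    where open ≡-Reasoning

carry-join : ∀ {b x y t s} → (t ≡ s × x ≡ y) ⊎ (t ≡ s + b × suc x ≡ y) → t + b * x ≡ s + b * y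
carry-join                 (inj₁ (refl , refl)) = refl
carry-join {b} {x} {s = s} (inj₂ (refl , refl)) =
  trans (+-assoc s b (b * x)) (cong (s +_) (sym (*-suc b x)))

carry-cases : ∀ {b x y t s} → t < b + b → s < b →
              (t + b * x ≡ s + b * y) ↔ ((t ≡ s × x ≡ y) ⊎ (t ≡ s + b × suc x ≡ y))
carry-cases {suc b} {s = s} t<b+b s<b = irrelevant-⇔⇒↔ ≡-irrelevant
  (⊎-irrelevant (×-irrelevant ≡-irrelevant ≡-irrelevant) (×-irrelevant ≡-irrelevant ≡-irrelevant)
    λ (t≡s , _) (t≡s+b , _) → m≢1+m+n s (trans (trans (sym t≡s) t≡s+b) (+-suc s b)))
  (carry-split t<b+b s<b) carry-join

countR  : ℕ → ℕ
countQ  : ℕ → ℕ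
countQ⁻ : ℕ → ℕ
countR zero     = 1
countR (suc n)  = 2 * countR n + countQ⁻ n
countQ n        = countR n + 2 * countQ⁻ n
countQ⁻ zero    = 0
countQ⁻ (suc n) = countQ n

countR-closed  : ∀ n → 2 * countR n ≡ 3 ^ n + 1
countQ-closed  : ∀ n → 2 * countQ n + 1 ≡ 3 ^ suc n
countQ⁻-closed : ∀ n → 2 * countQ⁻ n + 1 ≡ 3 ^ n

countR-closed zero    = refl
countR-closed (suc n) = step (countR n) (countQ⁻ n) (3 ^ n) (countR-closed n) (countQ⁻-closed n)
  where
  step : ∀ R Q t → 2 * R ≡ t + 1 → 2 * Q + 1 ≡ t → 2 * (2 * R + Q) ≡ 3 * t + 1
  step R Q t 2R≡t+1 2Q+1≡t = +-cancelʳ-≡ 1 _ _ (begin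
    2 * (2 * R + Q) + 1       ≡⟨ regroup R Q ⟩
    2 * (2 * R) + (2 * Q + 1) ≡⟨ cong₂ (λ x y → 2 * x + y) 2R≡t+1 2Q+1≡t ⟩
    2 * (t + 1) + t           ≡⟨ collect t ⟩
    3 * t + 1 + 1             ∎)
    where
    open ≡-Reasoning
    regroup : ∀ R Q → 2 * (2 * R + Q) + 1 ≡ 2 * (2 * R) + (2 * Q + 1)
    regroup = solve-∀
    collect : ∀ t → 2 * (t + 1) + t ≡ 3 * t + 1 + 1
    collect = solve-∀

countQ-closed n = step (countR n) (countQ⁻ n) (3 ^ n) (countR-closed n) (countQ⁻-closed n)
  where
  step : ∀ R Q t → 2 * R ≡ t + 1 → 2 * Q + 1 ≡ t → 2 * (R + 2 * Q) + 1 ≡ 3 * t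
  step R Q t 2R≡t+1 2Q+1≡t = +-cancelʳ-≡ 1 _ _ (begin
    2 * (R + 2 * Q) + 1 + 1 ≡⟨ regroup R Q ⟩
    2 * R + 2 * (2 * Q + 1) ≡⟨ cong₂ (λ x y → x + 2 * y) 2R≡t+1 2Q+1≡t ⟩
    t + 1 + 2 * t           ≡⟨ collect t ⟩
    3 * t + 1               ∎)
    where
    open ≡-Reasoning
    regroup : ∀ R Q → 2 * (R + 2 * Q) + 1 + 1 ≡ 2 * R + 2 * (2 * Q + 1)
    regroup = solve-∀
    collect : ∀ t → t + 1 + 2 * t ≡ 3 * t + 1
    collect = solve-∀

countQ⁻-closed zero    = refl
countQ⁻-closed (suc n) = countQ-closed n

countQ-formula : ∀ n → (3 ^ suc n ∸ 1) / 2 ≡ countQ n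
countQ-formula n = begin
  (3 ^ suc n ∸ 1) / 2         ≡⟨ cong (λ m → (m ∸ 1) / 2) (sym (countQ-closed n)) ⟩
  (2 * countQ n + 1 ∸ 1) / 2  ≡⟨ cong (_/ 2) (m+n∸n≡m (2 * countQ n) 1) ⟩
  2 * countQ n / 2            ≡⟨ cong (_/ 2) (*-comm 2 (countQ n)) ⟩
  countQ n * 2 / 2            ≡⟨ m*n/n≡m (countQ n) 2 ⟩
  countQ n                    ∎
  where open ≡-Reasoning

countR-formula : ∀ n → (3 ^ n + 1) / 2 ≡ countR n
countR-formula n = begin
  (3 ^ n + 1) / 2   ≡⟨ cong (_/ 2) (sym (countR-closed n)) ⟩
  2 * countR n / 2  ≡⟨ cong (_/ 2) (*-comm 2 (countR n)) ⟩
  countR n * 2 / 2  ≡⟨ m*n/n≡m (countR n) 2 ⟩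
  countR n          ∎
  where open ≡-Reasoning

module Base (b : ℕ) (1<b : 1 < b) where

  private instance
    b-nonZero : NonZero b
    b-nonZero = >-nonZero (<-trans z<s 1<b)
    b∸1-nonZero : NonZero (b ∸ 1)
    b∸1-nonZero = >-nonZero (∸-monoˡ-≤ 1 1<b)

  ^-cancelʳ-≤ : ∀ {m n} → b ^ m ≤ b ^ n → m ≤ n
  ^-cancelʳ-≤ {m} {n} b^m≤b^n with m ≤? n
  ... | yes m≤n = m≤n
  ... | no  m≰n = contradiction b^m≤b^n (<⇒≱ (^-monoʳ-< b 1<b (≰⇒> m≰n)))

  ^-cancelʳ-< : ∀ {m n} → b ^ m < b ^ n → m < n
  ^-cancelʳ-< {m} {n} b^m<b^n with m <? n
  ... | yes m<n = m<n
  ... | no  m≮n = contradiction b^m<b^n (≤⇒≯ (^-monoʳ-≤ b (≮⇒≥ m≮n)))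

  ^-injective : ∀ {m n} → b ^ m ≡ b ^ n → m ≡ n
  ^-injective eq = ≤-antisym (^-cancelʳ-≤ (≤-reflexive eq)) (^-cancelʳ-≤ (≤-reflexive (sym eq)))

  record Digit : Set where
    constructor digit
    field
      plain     : ℕ
      plain≤b   : plain ≤ b
      overlined : Bool

  open Digit

  bit : Bool → ℕ
  bit false = 0
  bit true  = 1

  digitValue : Digit → ℕ
  digitValue (digit k _ o) = bit o + k

  digit-≡ : ∀ {k k′ p p′ o o′} → k ≡ k′ → o ≡ o′ → digit k p o ≡ digit k′ p′ o′
  digit-≡ {p = p} {p′} refl refl = cong (λ p → digit _ p _) (≤-irrelevant p p′)

  digitValue<b+b : ∀ d → digitValue d < b + b
  digitValue<b+b (digit k k≤b o) = begin-strict
    bit o + k  ≤⟨ +-mono-≤ (bit≤1 o) k≤b ⟩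
    1 + b      <⟨ +-monoˡ-< b 1<b ⟩
    b + b      ∎
    where
    open ≤-Reasoning
    bit≤1 : ∀ o → bit o ≤ 1
    bit≤1 false = z≤n
    bit≤1 true  = ≤-refl

  DigitOfValue : ℕ → Set
  DigitOfValue = Fibre digitValue

  digitOfValue-zero : DigitOfValue 0 ↔ ⊤
  digitOfValue-zero = mk↔ₛ′ _ (λ _ → digit 0 z≤n false , refl) (λ _ → refl)
    λ { (digit 0 _ false , refl) → fibre-≡ (digit-≡ refl refl) }

  digitOfValue-between : ∀ {t} → 1 ≤ t → t ≤ b → DigitOfValue t ↔ Bool
  digitOfValue-between {t} 1≤t t≤b = mk↔ₛ′ (overlined ∘ proj₁) withFlag (λ _ → refl)
    λ { (digit k _ o , refl) → fibre-≡ (digit-≡ (m+n∸m≡n (bit o) k) refl) }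
    where
    bit≤t : ∀ o → bit o ≤ t
    bit≤t false = z≤n
    bit≤t true  = 1≤t
    withFlag : Bool → DigitOfValue t
    withFlag o = digit (t ∸ bit o) (≤-trans (m∸n≤m t (bit o)) t≤b) o , m+[n∸m]≡n (bit≤t o)

  digitOfValue-top : DigitOfValue (suc b) ↔ ⊤
  digitOfValue-top = mk↔ₛ′ _ (λ _ → digit b ≤-refl true , refl) (λ _ → refl)
    λ { (digit k k≤b false , k≡1+b) → contradiction (subst (_≤ b) k≡1+b k≤b) 1+n≰n
      ; (digit k _ true , 1+k≡1+b)  → fibre-≡ (digit-≡ (sym (suc-injective 1+k≡1+b)) refl) }

  -- Digit strings, most significant digit first

  evalDigits : ∀ {N} → Vec Digit N → ℕ
  evalDigits []            = 0
  evalDigits (_∷_ {N} d v) = digitValue d * b ^ N + evalDigits v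

  evalDigits-∷ʳ : ∀ {N} (v : Vec Digit N) d → evalDigits (v ∷ʳ d) ≡ digitValue d + b * evalDigits v
  evalDigits-∷ʳ []            d = units b (digitValue d)
    where
    units : ∀ b x → x * 1 + 0 ≡ x + b * 0
    units = solve-∀
  evalDigits-∷ʳ (_∷_ {N} x v) d = begin
    digitValue x * (b * b ^ N) + evalDigits (v ∷ʳ d)
      ≡⟨ cong (digitValue x * (b * b ^ N) +_) (evalDigits-∷ʳ v d) ⟩
    digitValue x * (b * b ^ N) + (digitValue d + b * evalDigits v)
      ≡⟨ horner b (digitValue x) (b ^ N) (evalDigits v) (digitValue d) ⟩
    digitValue d + b * (digitValue x * b ^ N + evalDigits v) ∎
    where
    open ≡-Reasoning
    horner : ∀ b x p e d → x * (b * p) + (d + b * e) ≡ d + b * (x * p + e)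
    horner = solve-∀

  Rep : ℕ → ℕ → Set
  Rep N = Fibre (evalDigits {N})

  Rep⁻ : ℕ → ℕ → Set
  Rep⁻ N = Fibre (suc ∘ evalDigits {N})

  -- Overpartitions as digit strings

  Below : ℕ → Entry → Set
  Below N x = proj₁ x < N

  block : ℕ → Digit → List Entry
  block e (digit k _ false) = replicate k (e , false)
  block e (digit k _ true)  = (e , true) ∷ replicate k (e , false)

  toParts : ∀ {N} → Vec Digit N → List Entry
  toParts []            = []
  toParts (_∷_ {N} d v) = block N d ++ toParts v

  partSum-++ : ∀ xs ys → partSum b (xs ++ ys) ≡ partSum b xs + partSum b ys
  partSum-++ []       ys = refl
  partSum-++ (x ∷ xs) ys = trans (cong (value b x +_) (partSum-++ xs ys)) (sym (+-assoc (value b x) _ _))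

  partSum-replicate : ∀ k e → partSum b (replicate k (e , false)) ≡ k * b ^ e
  partSum-replicate zero    e = refl
  partSum-replicate (suc k) e = cong (b ^ e +_) (partSum-replicate k e)

  partSum-block : ∀ e d → partSum b (block e d) ≡ digitValue d * b ^ e
  partSum-block e (digit k _ false) = partSum-replicate k e
  partSum-block e (digit k _ true)  = cong (b ^ e +_) (partSum-replicate k e)

  partSum-toParts : ∀ {N} (v : Vec Digit N) → partSum b (toParts v) ≡ evalDigits v
  partSum-toParts []            = refl
  partSum-toParts (_∷_ {N} d v) = begin
    partSum b (block N d ++ toParts v)             ≡⟨ partSum-++ (block N d) (toParts v) ⟩
    partSum b (block N d) + partSum b (toParts v)  ≡⟨ cong₂ _+_ (partSum-block N d) (partSum-toParts v) ⟩
    digitValue d * b ^ N + evalDigits v            ∎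
    where open ≡-Reasoning

  partSum<⇒below : ∀ {N} l → partSum b l < b ^ N → All (Below N) l
  partSum<⇒below []            _       = []
  partSum<⇒below ((e , o) ∷ l) sum<b^N =
    ^-cancelʳ-< (≤-<-trans (m≤m+n (b ^ e) (partSum b l)) sum<b^N)
      ∷ partSum<⇒below l (≤-<-trans (m≤n+m (partSum b l) (b ^ e)) sum<b^N)

  block-exponents : ∀ e d → All (λ x → proj₁ x ≡ e) (block e d)
  block-exponents e (digit k _ false) = replicate⁺ k refl
  block-exponents e (digit k _ true)  = refl ∷ replicate⁺ k refl

  toParts-below : ∀ {N} (v : Vec Digit N) → All (Below N) (toParts v)
  toParts-below []            = []
  toParts-below (_∷_ {N} d v) =
    ++⁺ (All.map (λ e≡N → ≤-reflexive (cong suc e≡N)) (block-exponents N d))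
        (All.map m<n⇒m<1+n (toParts-below v))

  ExponentsNonIncreasing : List Entry → Set
  ExponentsNonIncreasing = Linked (λ x y → proj₁ y ≤ proj₁ x)

  ∷-exponentsNonIncreasing : ∀ {e o l} → All (λ y → proj₁ y ≤ e) l →
    ExponentsNonIncreasing l → ExponentsNonIncreasing ((e , o) ∷ l)
  ∷-exponentsNonIncreasing []        []  = [-]
  ∷-exponentsNonIncreasing (y≤e ∷ _) ni = y≤e ∷ ni

  replicate-++-exponentsNonIncreasing : ∀ {e l} k → All (λ y → proj₁ y ≤ e) l →
    ExponentsNonIncreasing l → ExponentsNonIncreasing (replicate k (e , false) ++ l)
  replicate-++-exponentsNonIncreasing zero    _   ni = ni
  replicate-++-exponentsNonIncreasing (suc k) l≤e ni =
    ∷-exponentsNonIncreasing (++⁺ (replicate⁺ k ≤-refl) l≤e) (replicate-++-exponentsNonIncreasing k l≤e ni)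

  block-++-exponentsNonIncreasing : ∀ {e l} d → All (λ y → proj₁ y ≤ e) l →
    ExponentsNonIncreasing l → ExponentsNonIncreasing (block e d ++ l)
  block-++-exponentsNonIncreasing (digit k _ false) l≤e ni = replicate-++-exponentsNonIncreasing k l≤e ni
  block-++-exponentsNonIncreasing (digit k _ true)  l≤e ni =
    ∷-exponentsNonIncreasing (++⁺ (replicate⁺ k ≤-refl) l≤e) (replicate-++-exponentsNonIncreasing k l≤e ni)

  toParts-nonIncreasing : ∀ {N} (v : Vec Digit N) → NonIncreasing b (toParts v)
  toParts-nonIncreasing v = Linked.map (^-monoʳ-≤ b) (exponentsNonIncreasing v)
    where
    exponentsNonIncreasing : ∀ {N} (v : Vec Digit N) → ExponentsNonIncreasing (toParts v)
    exponentsNonIncreasing []            = []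
    exponentsNonIncreasing (_∷_ {N} d v) =
      block-++-exponentsNonIncreasing d (All.map <⇒≤ (toParts-below v)) (exponentsNonIncreasing v)

  Fresh : ℕ → Maybe ℕ → Set
  Fresh N p = ∀ {e} → e < N → p ≢ just (b ^ e)

  just-b^N-fresh : ∀ {N} → Fresh N (just (b ^ N))
  just-b^N-fresh e<N eq = <⇒≢ (^-monoʳ-< b 1<b e<N) (sym (just-injective eq))

  replicate-++-overlineFirst : ∀ {N p l} k → OverlineFirstFrom b p l →
    OverlineFirstFrom b (just (b ^ N)) l → OverlineFirstFrom b p (replicate k (N , false) ++ l)
  replicate-++-overlineFirst zero    after-p _         = after-p
  replicate-++-overlineFirst (suc k) _       after-b^N = replicate-++-overlineFirst k after-b^N after-b^N

  block-++-overlineFirst : ∀ {N p l} d → p ≢ just (b ^ N) → OverlineFirstFrom b p l →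
    OverlineFirstFrom b (just (b ^ N)) l → OverlineFirstFrom b p (block N d ++ l)
  block-++-overlineFirst (digit k _ false) _     after-p after-b^N =
    replicate-++-overlineFirst k after-p after-b^N
  block-++-overlineFirst (digit k _ true)  p≢b^N _       after-b^N =
    fromWitnessFalse p≢b^N , replicate-++-overlineFirst k after-b^N after-b^N

  toParts-overlineFirst : ∀ {N} (v : Vec Digit N) {p} → Fresh N p → OverlineFirstFrom b p (toParts v)
  toParts-overlineFirst []            _     = tt
  toParts-overlineFirst (_∷_ {N} d v) fresh =
    block-++-overlineFirst d (fresh ≤-refl) (toParts-overlineFirst v (fresh ∘ m<n⇒m<1+n))
                           (toParts-overlineFirst v just-b^N-fresh)

  count-same : ∀ e l → nonOverlinedCount b e ((e , false) ∷ l) ≡ suc (nonOverlinedCount b e l)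
  count-same e l rewrite Equivalence.to T-≡ (≡⇒≡ᵇ (b ^ e) (b ^ e) refl) = refl

  count-other : ∀ {e e′} l → e ≢ e′ →
    nonOverlinedCount b e ((e′ , false) ∷ l) ≡ nonOverlinedCount b e l
  count-other {e} {e′} l e≢e′ with b ^ e ≡ᵇ b ^ e′ in eq
  ... | true  = contradiction (^-injective (≡ᵇ⇒≡ _ _ (Equivalence.from T-≡ eq))) e≢e′
  ... | false = refl

  count-≤-∷ : ∀ e x l → nonOverlinedCount b e l ≤ nonOverlinedCount b e (x ∷ l)
  count-≤-∷ e (e′ , true)  l = ≤-refl
  count-≤-∷ e (e′ , false) l with b ^ e ≡ᵇ b ^ e′
  ... | true  = n≤1+n _
  ... | false = ≤-refl

  count-replicate-same : ∀ e k l →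
    nonOverlinedCount b e (replicate k (e , false) ++ l) ≡ k + nonOverlinedCount b e l
  count-replicate-same e zero    l = refl
  count-replicate-same e (suc k) l =
    trans (count-same e (replicate k (e , false) ++ l)) (cong suc (count-replicate-same e k l))

  count-replicate-other : ∀ {e e′} k l → e ≢ e′ →
    nonOverlinedCount b e (replicate k (e′ , false) ++ l) ≡ nonOverlinedCount b e l
  count-replicate-other         zero    l _    = refl
  count-replicate-other {e′ = e′} (suc k) l e≢e′ =
    trans (count-other (replicate k (e′ , false) ++ l) e≢e′) (count-replicate-other k l e≢e′)

  count-block : ∀ e e′ d l →
    nonOverlinedCount b e (block e′ d ++ l) ≡ nonOverlinedCount b e (replicate (plain d) (e′ , false) ++ l)
  count-block e e′ (digit k _ false) l = refl
  count-block e e′ (digit k _ true)  l = refl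

  count-below : ∀ {e} l → All (Below e) l → nonOverlinedCount b e l ≡ 0
  count-below []                 []           = refl
  count-below ((e′ , true) ∷ l)  (_ ∷ l<e)    = count-below l l<e
  count-below ((e′ , false) ∷ l) (e′<e ∷ l<e) = trans (count-other l (>⇒≢ e′<e)) (count-below l l<e)

  toParts-count : ∀ {N} (v : Vec Digit N) e → nonOverlinedCount b e (toParts v) ≤ b
  toParts-count []            e = z≤n
  toParts-count (_∷_ {N} d v) e with e ≟ N
  ... | yes refl = subst (_≤ b) (sym count≡plain) (plain≤b d)
    where
    open ≡-Reasoning
    count≡plain : nonOverlinedCount b N (block N d ++ toParts v) ≡ plain d
    count≡plain = begin
      nonOverlinedCount b N (block N d ++ toParts v)
        ≡⟨ count-block N N d (toParts v) ⟩
      nonOverlinedCount b N (replicate (plain d) (N , false) ++ toParts v)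
        ≡⟨ count-replicate-same N (plain d) (toParts v) ⟩
      plain d + nonOverlinedCount b N (toParts v)
        ≡⟨ cong (plain d +_) (count-below (toParts v) (toParts-below v)) ⟩
      plain d + 0
        ≡⟨ +-identityʳ (plain d) ⟩
      plain d ∎
  ... | no e≢N = subst (_≤ b) (sym count≡) (toParts-count v e)
    where
    count≡ = trans (count-block e N d (toParts v)) (count-replicate-other (plain d) (toParts v) e≢N)

  toParts-restricted : ∀ {N} (v : Vec Digit N) → Restricted b (toParts v)
  toParts-restricted v = All.universal (λ x → toParts-count v (proj₁ x)) (toParts v)

  replicate-++-injective : ∀ {N l l′} k k′ → All (Below N) l → All (Below N) l′ →
    replicate k (N , false) ++ l ≡ replicate k′ (N , false) ++ l′ → k ≡ k′ × l ≡ l′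
  replicate-++-injective zero    zero     _         _         eq   = refl , eq
  replicate-++-injective zero    (suc k′) (N<N ∷ _) _         refl = contradiction N<N (n≮n _)
  replicate-++-injective (suc k) zero     _         (N<N ∷ _) refl = contradiction N<N (n≮n _)
  replicate-++-injective (suc k) (suc k′) l<N       l′<N      eq   =
    let k≡k′ , l≡l′ = replicate-++-injective k k′ l<N l′<N (proj₂ (∷-injective eq))
    in cong suc k≡k′ , l≡l′

  block-++-injective : ∀ {N l l′} d d′ → All (Below N) l → All (Below N) l′ →
    block N d ++ l ≡ block N d′ ++ l′ → d ≡ d′ × l ≡ l′
  block-++-injective (digit k _ false) (digit k′ _ false) l<N l′<N eq =
    let k≡k′ , l≡l′ = replicate-++-injective k k′ l<N l′<N eq in digit-≡ k≡k′ refl , l≡l′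
  block-++-injective (digit k _ true)  (digit k′ _ true)  l<N l′<N eq =
    let k≡k′ , l≡l′ = replicate-++-injective k k′ l<N l′<N (proj₂ (∷-injective eq))
    in digit-≡ k≡k′ refl , l≡l′
  block-++-injective (digit k _ true)        (digit zero _ false) _ (N<N ∷ _) refl = contradiction N<N (n≮n _)
  block-++-injective (digit zero _ false)    (digit k′ _ true)    (N<N ∷ _) _ refl = contradiction N<N (n≮n _)
  block-++-injective (digit k _ true)        (digit (suc k′) _ false) _ _ ()
  block-++-injective (digit (suc k) _ false) (digit k′ _ true)        _ _ ()

  toParts-injective : ∀ {N} (v w : Vec Digit N) → toParts v ≡ toParts w → v ≡ w
  toParts-injective []      []       _  = refl
  toParts-injective (d ∷ v) (d′ ∷ w) eq =
    let d≡d′ , rest≡ = block-++-injective d d′ (toParts-below v) (toParts-below w) eq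
    in cong₂ _∷_ d≡d′ (toParts-injective v w rest≡)

  ValidAfter : Maybe ℕ → List Entry → Set
  ValidAfter p l = NonIncreasing b l × OverlineFirstFrom b p l × Restricted b l

  validAfter-tail : ∀ {p} x l → ValidAfter p (x ∷ l) → ValidAfter (just (value b x)) l
  validAfter-tail x l (ni , of , _ ∷ rs) =
    Linked.tail ni , overlineFirst-tail x of , All.map (λ {y} → ≤-trans (count-≤-∷ (proj₁ y) x l)) rs
    where
    overlineFirst-tail : ∀ {p} x → OverlineFirstFrom b p (x ∷ l) → OverlineFirstFrom b (just (value b x)) l
    overlineFirst-tail (e , true)  = proj₂
    overlineFirst-tail (e , false) = λ of → of

  nonIncreasing-below : ∀ {N} x l → NonIncreasing b (x ∷ l) → Below N x → All (Below N) (x ∷ l)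
  nonIncreasing-below x l ni x<N =
    All.map (λ y≤x → ≤-<-trans (^-cancelʳ-≤ y≤x) x<N)
            (Linked⇒All (λ p q → ≤-trans q p) {v = x} ≤-refl ni)

  Run : ℕ → List Entry → Set
  Run N l = Σ ℕ λ k → Σ (List Entry) λ l′ →
    l ≡ replicate k (N , false) ++ l′ × ValidAfter (just (b ^ N)) l′ × All (Below N) l′

  run : ∀ N l → ValidAfter (just (b ^ N)) l → All (Below (suc N)) l → Run N l
  run N []            valid _ = 0 , [] , refl , valid , []
  run N ((e , true) ∷ l) valid (e<1+N ∷ _) with m<1+n⇒m<n∨m≡n e<1+N
  ... | inj₁ e<N  = 0 , _ , refl , valid , nonIncreasing-below _ l (proj₁ valid) e<N
  ... | inj₂ refl = contradiction refl (toWitnessFalse (proj₁ (proj₁ (proj₂ valid))))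
  run N ((e , false) ∷ l) valid (e<1+N ∷ l<1+N) with m<1+n⇒m<n∨m≡n e<1+N
  ... | inj₁ e<N  = 0 , _ , refl , valid , nonIncreasing-below _ l (proj₁ valid) e<N
  ... | inj₂ refl =
    let k , l′ , l≡ , valid′ , l′<N = run N l (validAfter-tail {just (b ^ N)} (e , false) l valid) l<1+N
    in suc k , l′ , cong ((e , false) ∷_) l≡ , valid′ , l′<N

  run-count : ∀ {N k l l′} → l ≡ replicate k (N , false) ++ l′ → All (Below N) l′ →
    nonOverlinedCount b N l ≡ k
  run-count {N} {k} {l′ = l′} refl l′<N = begin
    nonOverlinedCount b N (replicate k (N , false) ++ l′)  ≡⟨ count-replicate-same N k l′ ⟩
    k + nonOverlinedCount b N l′                           ≡⟨ cong (k +_) (count-below l′ l′<N) ⟩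
    k + 0                                                  ≡⟨ +-identityʳ k ⟩
    k                                                      ∎
    where open ≡-Reasoning

  block-of-run : ∀ {N} o {k l l′} → nonOverlinedCount b N ((N , o) ∷ l) ≤ b →
    l ≡ replicate k (N , false) ++ l′ → All (Below N) l′ → Σ Digit λ d → (N , o) ∷ l ≡ block N d ++ l′
  block-of-run true count≤b l≡@refl l′<N =
    digit _ (subst (_≤ b) (run-count l≡ l′<N) count≤b) true , refl
  block-of-run {N} false {l = l} count≤b l≡@refl l′<N =
    digit _ (subst (_≤ b) (trans (count-same N l) (cong suc (run-count l≡ l′<N))) count≤b) false , refl

  parse : ∀ N {p} l → ValidAfter p l → All (Below N) l → Σ (Vec Digit N) λ v → l ≡ toParts v
  parse zero    []            _     _       = [] , refl
  parse zero    (_ ∷ _)       _     (() ∷ _)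
  parse (suc N) {p} []        valid _       = let v , eq = parse N {p} [] valid [] in digit 0 z≤n false ∷ v , eq
  parse (suc N) ((e , o) ∷ l) valid (e<1+N ∷ l<1+N) with m<1+n⇒m<n∨m≡n e<1+N
  ... | inj₁ e<N =
    let v , eq = parse N _ valid (nonIncreasing-below _ l (proj₁ valid) e<N) in digit 0 z≤n false ∷ v , eq
  ... | inj₂ refl =
    let k , l′ , l≡ , valid′ , l′<N = run N l (validAfter-tail (e , o) l valid) l<1+N
        v , l′≡ = parse N l′ valid′ l′<N
        d , head≡ = block-of-run o (All.head (proj₂ (proj₂ valid))) l≡ l′<N
    in d ∷ v , trans head≡ (cong (block e d ++_) l′≡)

  overlineFirst-irrelevant : ∀ p l → Irrelevant (OverlineFirstFrom b p l)
  overlineFirst-irrelevant p []                _        _          = refl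
  overlineFirst-irrelevant p ((e , false) ∷ l) of       of′        = overlineFirst-irrelevant _ l of of′
  overlineFirst-irrelevant p ((e , true) ∷ l)  (x , of) (x′ , of′) =
    cong₂ _,_ (T-irrelevant x x′) (overlineFirst-irrelevant _ l of of′)

  overpartition-≡ : ∀ {m} {x y : RestrictedOverpartition b m} → proj₁ x ≡ proj₁ y → x ≡ y
  overpartition-≡ {x = l , p} {y = .l , p′} refl = cong (l ,_)
    (×-irrelevant (linked-irrelevant ≤-irrelevant)
      (×-irrelevant (overlineFirst-irrelevant nothing l)
        (×-irrelevant ≡-irrelevant (All.irrelevant ≤-irrelevant))) p p′)

  overpartition↔Rep : ∀ {N m} → m < b ^ N → RestrictedOverpartition b m ↔ Rep N m
  overpartition↔Rep {N} {m} m<b^N = mk↔ₛ′ digitsOf fromDigits digitsOf∘fromDigits fromDigits∘digitsOf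
    where
    parsed : (x : RestrictedOverpartition b m) → Σ (Vec Digit N) λ v → proj₁ x ≡ toParts v
    parsed (l , ni , of , sum≡m , rs) =
      parse N l (ni , of , rs) (partSum<⇒below l (subst (_< b ^ N) (sym sum≡m) m<b^N))

    digitsOf : RestrictedOverpartition b m → Rep N m
    digitsOf x@(l , _ , _ , sum≡m , _) = let v , l≡ = parsed x in v , (begin
      evalDigits v           ≡⟨ sym (partSum-toParts v) ⟩
      partSum b (toParts v)  ≡⟨ cong (partSum b) (sym l≡) ⟩
      partSum b l            ≡⟨ sum≡m ⟩
      m                      ∎)
      where open ≡-Reasoning

    fromDigits : Rep N m → RestrictedOverpartition b m
    fromDigits (v , v≡m) = toParts v , toParts-nonIncreasing v , toParts-overlineFirst v (λ _ ()) ,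
                           trans (partSum-toParts v) v≡m , toParts-restricted v

    digitsOf∘fromDigits : ∀ y → digitsOf (fromDigits y) ≡ y
    digitsOf∘fromDigits y = fibre-≡ (toParts-injective _ (proj₁ y) (sym (proj₂ (parsed (fromDigits y)))))

    fromDigits∘digitsOf : ∀ x → fromDigits (digitsOf x) ≡ x
    fromDigits∘digitsOf x = overpartition-≡ (sym (proj₂ (parsed x)))

  Rep-[] : Rep 0 0 ↔ ⊤
  Rep-[] = mk↔ₛ′ _ (λ _ → [] , refl) (λ _ → refl) λ { ([] , refl) → refl }

  Rep⁻-zero : ∀ {N} → Rep⁻ N 0 ↔ ⊥
  Rep⁻-zero = mk↔ₛ′ (λ ()) (λ ()) (λ ()) (λ ())

  Rep⁻-suc : ∀ {N m} → Rep⁻ N (suc m) ↔ Rep N m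
  Rep⁻-suc = congˡ (irrelevant-⇔⇒↔ ≡-irrelevant ≡-irrelevant suc-injective (cong suc))

  Rep-last : ∀ {N m} →
    Rep (suc N) m ↔ (Σ Digit λ d → Σ (Vec Digit N) λ v → digitValue d + b * evalDigits v ≡ m)
  Rep-last {N} {m} = begin
    Rep (suc N) m
      ↔⟨ Σ-↔ last-init-↔ (K-reflexive (cong (_≡ m) (evalDigits-last-init _))) ⟩
    Σ (Digit × Vec Digit N) (λ (d , v) → digitValue d + b * evalDigits v ≡ m)
      ↔⟨ Σ-assoc ⟩
    (Σ Digit λ d → Σ (Vec Digit N) λ v → digitValue d + b * evalDigits v ≡ m) ∎
    where
    open EquationalReasoning
    evalDigits-last-init : ∀ (v : Vec Digit (suc N)) →
      evalDigits v ≡ digitValue (last v) + b * evalDigits (init v)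
    evalDigits-last-init v =
      trans (cong evalDigits (proj₂ (proj₂ (initLast v)))) (evalDigits-∷ʳ (init v) (last v))

  Rep-split : ∀ {N y s} → s < b →
    Rep (suc N) (s + b * y) ↔ ((DigitOfValue s × Rep N y) ⊎ (DigitOfValue (s + b) × Rep⁻ N y))
  Rep-split {N} {y} {s} s<b = begin
    Rep (suc N) (s + b * y)
      ↔⟨ Rep-last ⟩
    (Σ Digit λ d → Σ (Vec Digit N) λ v → digitValue d + b * evalDigits v ≡ s + b * y)
      ↔⟨ congˡ (λ {d} → congˡ (carry-cases (digitValue<b+b d) s<b)) ⟩
    (Σ Digit λ d → Σ (Vec Digit N) λ v →
       (digitValue d ≡ s × evalDigits v ≡ y) ⊎ (digitValue d ≡ s + b × suc (evalDigits v) ≡ y))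
      ↔⟨ Σ²-distrib-⊎-× ⟩
    ((DigitOfValue s × Rep N y) ⊎ (DigitOfValue (s + b) × Rep⁻ N y)) ∎
    where open EquationalReasoning

  repunit : ℕ → ℕ
  repunit zero    = 0
  repunit (suc n) = 1 + b * repunit n

  Rep-repunit   : ∀ n → Rep n (repunit n) ↔ Fin (countR n)
  Rep⁻-repunit  : ∀ n → Rep⁻ n (repunit n) ↔ Fin (countQ⁻ n)
  Rep-b*repunit : ∀ n → Rep (suc n) (b * repunit n) ↔ Fin (countQ n)

  Rep-repunit zero    = ↔-sym 1↔⊤ ↔-∘ Rep-[]
  Rep-repunit (suc n) = begin
    Rep (suc n) (1 + b * repunit n)
      ↔⟨ Rep-split 1<b ⟩
    ((DigitOfValue 1 × Rep n (repunit n)) ⊎ (DigitOfValue (suc b) × Rep⁻ n (repunit n)))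
      ↔⟨ ((↔-sym 2↔Bool ↔-∘ digitOfValue-between ≤-refl (<⇒≤ 1<b)) ×-↔ Rep-repunit n)
         ⊎-↔ ((↔-sym 1↔⊤ ↔-∘ digitOfValue-top) ×-↔ Rep⁻-repunit n) ⟩
    ((Fin 2 × Fin (countR n)) ⊎ (Fin 1 × Fin (countQ⁻ n)))
      ↔⟨ ⊎-×-↔-Fin ⟩
    Fin (2 * countR n + 1 * countQ⁻ n)
      ≡⟨ cong (λ k → Fin (2 * countR n + k)) (*-identityˡ (countQ⁻ n)) ⟩
    Fin (countR (suc n)) ∎
    where open EquationalReasoning

  Rep⁻-repunit zero    = ↔-sym 0↔⊥ ↔-∘ Rep⁻-zero
  Rep⁻-repunit (suc n) = Rep-b*repunit n ↔-∘ Rep⁻-suc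

  Rep-b*repunit n = begin
    Rep (suc n) (0 + b * repunit n)
      ↔⟨ Rep-split (<-trans z<s 1<b) ⟩
    ((DigitOfValue 0 × Rep n (repunit n)) ⊎ (DigitOfValue b × Rep⁻ n (repunit n)))
      ↔⟨ ((↔-sym 1↔⊤ ↔-∘ digitOfValue-zero) ×-↔ Rep-repunit n)
         ⊎-↔ ((↔-sym 2↔Bool ↔-∘ digitOfValue-between (<⇒≤ 1<b) ≤-refl) ×-↔ Rep⁻-repunit n) ⟩
    ((Fin 1 × Fin (countR n)) ⊎ (Fin 2 × Fin (countQ⁻ n)))
      ↔⟨ ⊎-×-↔-Fin ⟩
    Fin (1 * countR n + 2 * countQ⁻ n)
      ≡⟨ cong (λ k → Fin (k + 2 * countQ⁻ n)) (*-identityˡ (countR n)) ⟩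
    Fin (countQ n) ∎
    where open EquationalReasoning

  repunit-closed : ∀ n → (b ∸ 1) * repunit n + 1 ≡ b ^ n
  repunit-closed zero    = cong (_+ 1) (*-zeroʳ (b ∸ 1))
  repunit-closed (suc n) = begin
    (b ∸ 1) * (1 + b * repunit n) + 1
      ≡⟨ cong (λ c → (b ∸ 1) * (1 + c * repunit n) + 1) (sym b∸1+1≡b) ⟩
    (b ∸ 1) * (1 + (b ∸ 1 + 1) * repunit n) + 1
      ≡⟨ step (b ∸ 1) (repunit n) ⟩
    (b ∸ 1 + 1) * ((b ∸ 1) * repunit n + 1)
      ≡⟨ cong₂ _*_ b∸1+1≡b (repunit-closed n) ⟩
    b * b ^ n ∎
    where
    open ≡-Reasoning
    b∸1+1≡b : b ∸ 1 + 1 ≡ b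
    b∸1+1≡b = m∸n+n≡m (<⇒≤ 1<b)
    step : ∀ β R → β * (1 + (β + 1) * R) + 1 ≡ (β + 1) * (β * R + 1)
    step = solve-∀

  repunit<b^n : ∀ n → repunit n < b ^ n
  repunit<b^n n = begin-strict
    repunit n                ≤⟨ m≤n*m (repunit n) (b ∸ 1) ⟩
    (b ∸ 1) * repunit n      <⟨ m<m+n _ z<s ⟩
    (b ∸ 1) * repunit n + 1  ≡⟨ repunit-closed n ⟩
    b ^ n                    ∎
    where open ≤-Reasoning

  b*repunit<b^suc : ∀ n → b * repunit n < b ^ suc n
  b*repunit<b^suc n = *-monoʳ-< b (repunit<b^n n)

  q≡b*repunit : ∀ n → q b 1<b n ≡ b * repunit n
  q≡b*repunit n = begin
    (b ^ suc n ∸ b) / (b ∸ 1)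
      ≡⟨ cong (λ m → (b * m ∸ b) / (b ∸ 1)) (sym (repunit-closed n)) ⟩
    (b * ((b ∸ 1) * repunit n + 1) ∸ b) / (b ∸ 1)
      ≡⟨ cong (λ m → (m ∸ b) / (b ∸ 1)) (expand b (b ∸ 1) (repunit n)) ⟩
    (b * repunit n * (b ∸ 1) + b ∸ b) / (b ∸ 1)
      ≡⟨ cong (_/ (b ∸ 1)) (m+n∸n≡m _ b) ⟩
    b * repunit n * (b ∸ 1) / (b ∸ 1)
      ≡⟨ m*n/n≡m (b * repunit n) (b ∸ 1) ⟩
    b * repunit n ∎
    where
    open ≡-Reasoning
    expand : ∀ b β R → b * (β * R + 1) ≡ b * R * β + b
    expand = solve-∀

  r≡repunit : ∀ n → r b 1<b n ≡ repunit n
  r≡repunit n = begin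
    (b ^ n ∸ 1) / (b ∸ 1)                    ≡⟨ cong (λ m → (m ∸ 1) / (b ∸ 1)) (sym (repunit-closed n)) ⟩
    ((b ∸ 1) * repunit n + 1 ∸ 1) / (b ∸ 1)  ≡⟨ cong (_/ (b ∸ 1)) (m+n∸n≡m _ 1) ⟩
    (b ∸ 1) * repunit n / (b ∸ 1)            ≡⟨ cong (_/ (b ∸ 1)) (*-comm (b ∸ 1) (repunit n)) ⟩
    repunit n * (b ∸ 1) / (b ∸ 1)            ≡⟨ m*n/n≡m (repunit n) (b ∸ 1) ⟩
    repunit n                                ∎
    where open ≡-Reasoning

corollary9p7 : (b : ℕ) (hb : 2 ≤ b) (n : ℕ) →
    (RestrictedOverpartition b (q b hb n) ↔ Fin ((3 ^ suc n ∸ 1) / 2))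
    × (RestrictedOverpartition b (r b hb n) ↔ Fin ((3 ^ n + 1) / 2))
corollary9p7 b hb n = overpartitions-q , overpartitions-r
  where
  open Base b hb
  open EquationalReasoning

  overpartitions-q : RestrictedOverpartition b (q b hb n) ↔ Fin ((3 ^ suc n ∸ 1) / 2)
  overpartitions-q = begin
    RestrictedOverpartition b (q b hb n)       ≡⟨ cong (RestrictedOverpartition b) (q≡b*repunit n) ⟩
    RestrictedOverpartition b (b * repunit n)  ↔⟨ overpartition↔Rep (b*repunit<b^suc n) ⟩
    Rep (suc n) (b * repunit n)                ↔⟨ Rep-b*repunit n ⟩
    Fin (countQ n)                             ≡⟨ cong Fin (sym (countQ-formula n)) ⟩
    Fin ((3 ^ suc n ∸ 1) / 2)                  ∎

  overpartitions-r : RestrictedOverpartition b (r b hb n) ↔ Fin ((3 ^ n + 1) / 2)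
  overpartitions-r = begin
    RestrictedOverpartition b (r b hb n)   ≡⟨ cong (RestrictedOverpartition b) (r≡repunit n) ⟩
    RestrictedOverpartition b (repunit n)  ↔⟨ overpartition↔Rep (repunit<b^n n) ⟩
    Rep n (repunit n)                      ↔⟨ Rep-repunit n ⟩
    Fin (countR n)                         ≡⟨ cong Fin (sym (countR-formula n)) ⟩
    Fin ((3 ^ n + 1) / 2)                  ∎
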